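{- In the system $\mathcal{D}$, for all multisets $\Gamma$ and propositions $A$, $B$, $C$, $D$, $G$: (1) if $A=C\wedge D$ and $\Gamma, A\Rightarrow B\vdash G$ has a proof, then $\Gamma, C\Rightarrow B\vdash G$ and $\Gamma, D\Rightarrow B\vdash G$ have proofs; (2) if $A=C\vee D$ and $\Gamma, A\Rightarrow B\vdash G$ has a proof, then $\Gamma, C\Rightarrow B, D\Rightarrow B\vdash G$ has a proof; (3) if $A=C\Rightarrow D$ and $\Gamma, A\Rightarrow B\vdash G$ has a proof, then $\Gamma, D\Rightarrow B, C\vdash G$ has a proof; (4) if $\Gamma, A, A\vdash G$ has a proof, then $\Gamma, A\vdash G$ has a proof; (5) if $\Gamma, A\Rightarrow B\vdash A$ has a proof and $\Gamma, B\vdash G$ has a proof, then $\Gamma, A\Rightarrow B\vdash G$ has a proof.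
   Context: Propositions are first-order formulas built from atomic propositions $P(t_1,\dots,t_k)$ (predicate symbol applied to terms; $\top,\bot$ are not atomic), $\top$, $\bot$, $\wedge$, $\vee$, $\Rightarrow$, $\forall$, $\exists$. Sequents are $\Gamma\vdash G$ with $\Gamma$ a finite multiset of propositions and $G$ a proposition. The system $\mathcal{D}$ has the rules: axiom $\Gamma,P\vdash P$ ($P$ atomic); $\top$-right $\Gamma\vdash\top$; $\bot$-left $\Gamma,\bot\vdash G$; $\wedge$-left (from $\Gamma,A,B\vdash G$ infer $\Gamma,A\wedge B\vdash G$); $\wedge$-right (from $\Gamma\vdash A$, $\Gamma\vdash B$ infer $\Gamma\vdash A\wedge B$); $\vee$-left (from $\Gamma,A\vdash G$, $\Gamma,B\vdash G$ infer $\Gamma,A\vee B\vdash G$); $\vee$-right (from $\Gamma\vdash A$, or from $\Gamma\vdash B$, infer $\Gamma\vdash A\vee B$); $\Rightarrow$-left$_{axiom}$ (from $\Gamma,P,B\vdash G$ infer $\Gamma,P,P\Rightarrow B\vdash G$, $P$ atomic); $\Rightarrow$-left$_\top$ (from $\Gamma,B\vdash G$ infer $\Gamma,\top\Rightarrow B\vdash G$); $\Rightarrow$-left$_\wedge$ (from $\Gamma,C\Rightarrow B\vdash C$, $\Gamma,D\Rightarrow B\vdash D$, $\Gamma,B\vdash G$ infer $\Gamma,(C\wedge D)\Rightarrow B\vdash G$); two $\Rightarrow$-left$_\vee$ rules (from $\Gamma,C\Rightarrow B,D\Rightarrow B\vdash C$ and $\Gamma,B\vdash G$, resp. from $\Gamma,C\Rightarrow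 B,D\Rightarrow B\vdash D$ and $\Gamma,B\vdash G$, infer $\Gamma,(C\vee D)\Rightarrow B\vdash G$); $\Rightarrow$-left$_\Rightarrow$ (from $\Gamma,D\Rightarrow B,C\vdash D$ and $\Gamma,B\vdash G$ infer $\Gamma,(C\Rightarrow D)\Rightarrow B\vdash G$); $\Rightarrow$-left$_\forall$ (from $\Gamma,(\forall x\,C)\Rightarrow B\vdash C$ and $\Gamma,B\vdash G$ infer $\Gamma,(\forall x\,C)\Rightarrow B\vdash G$, $x$ not free in $\Gamma,B$); $\Rightarrow$-left$_\exists$ (from $\Gamma,(\exists x\,C)\Rightarrow B\vdash(t/x)C$ and $\Gamma,B\vdash G$ infer $\Gamma,(\exists x\,C)\Rightarrow B\vdash G$); $\Rightarrow$-right (from $\Gamma,A\vdash B$ infer $\Gamma\vdash A\Rightarrow B$); $\forall$-right (from $\Gamma\vdash A$ infer $\Gamma\vdash\forall x\,A$, $x$ not free in $\Gamma$); contr-$\forall$-left (from $\Gamma,\forall x\,A,(t/x)A\vdash G$ infer $\Gamma,\forall x\,A\vdash G$); $\exists$-left (from $\Gamma,A\vdash G$ infer $\Gamma,\exists x\,A\vdash G$, $x$ not free in $\Gamma,G$); $\exists$-right (from $\Gamma\vdash(t/x)A$ infer $\Gamma\vdash\exists x\,A$). Here $t$ ranges over arbitrary terms. -}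

module Defs where

open import Data.Nat using (ℕ; zero; suc; pred; _≡ᵇ_; _<ᵇ_)
open import Data.Bool using (if_then_else_)
open import Data.List using (List; []; _∷_; map)
open import Data.List.Relation.Binary.Permutation.Propositional using (_↭_) public

-- First-order terms, variables as de Bruijn indices.
-- Function symbols are named by ℕ and applied to a list of arguments.
data Term : Set where
  var : ℕ → Term
  fun : ℕ → List Term → Term

infixr 6 _∧'_
infixr 5 _∨'_
infixr 4 _⇒_

-- Propositions; ∀' and ∃' bind de Bruijn index 0.
data Form : Set where
  atom : ℕ → List Term → Form
  ⊤' ⊥' : Form
  _∧'_ _∨'_ _⇒_ : Form → Form → Form
  ∀' ∃' : Form → Form

data Atomic : Form → Set where
  atomic : ∀ p ts → Atomic (atom p ts)

mutual
  shiftT : ℕ → Term → Term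
  shiftT c (var x) = if x <ᵇ c then var x else var (suc x)
  shiftT c (fun f ts) = fun f (shiftTs c ts)

  shiftTs : ℕ → List Term → List Term
  shiftTs c [] = []
  shiftTs c (t ∷ ts) = shiftT c t ∷ shiftTs c ts

shiftF : ℕ → Form → Form
shiftF c (atom p ts) = atom p (shiftTs c ts)
shiftF c ⊤' = ⊤'
shiftF c ⊥' = ⊥'
shiftF c (A ∧' B) = shiftF c A ∧' shiftF c B
shiftF c (A ∨' B) = shiftF c A ∨' shiftF c B
shiftF c (A ⇒ B) = shiftF c A ⇒ shiftF c B
shiftF c (∀' A) = ∀' (shiftF (suc c) A)
shiftF c (∃' A) = ∃' (shiftF (suc c) A)

-- weakening of a context (variable 0 becomes fresh, i.e. not free in it)
↑ : List Form → List Form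
↑ = map (shiftF 0)

mutual
  substT : ℕ → Term → Term → Term
  substT k s (var x) = if x ≡ᵇ k then s else (if x <ᵇ k then var x else var (pred x))
  substT k s (fun f ts) = fun f (substTs k s ts)

  substTs : ℕ → Term → List Term → List Term
  substTs k s [] = []
  substTs k s (t ∷ ts) = substT k s t ∷ substTs k s ts

substF : ℕ → Term → Form → Form
substF k s (atom p ts) = atom p (substTs k s ts)
substF k s ⊤' = ⊤'
substF k s ⊥' = ⊥'
substF k s (A ∧' B) = substF k s A ∧' substF k s B
substF k s (A ∨' B) = substF k s A ∨' substF k s B
substF k s (A ⇒ B) = substF k s A ⇒ substF k s B
substF k s (∀' A) = ∀' (substF (suc k) (shiftT 0 s) A)
substF k s (∃' A) = ∃' (substF (suc k) (shiftT 0 s) A)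

-- (t/x)A where A is the body of a binder
_[_] : Form → Term → Form
A [ t ] = substF 0 t A

infix 3 _⊢_

-- The system D. Contexts are lists considered as multisets: every left rule
-- acts on a principal formula anywhere in the context (Γ ↭ principal ∷ Δ).
data _⊢_ : List Form → Form → Set where
  ax      : ∀ {Γ Δ P} → Atomic P → Γ ↭ P ∷ Δ → Γ ⊢ P
  ⊤R      : ∀ {Γ} → Γ ⊢ ⊤'
  ⊥L      : ∀ {Γ Δ G} → Γ ↭ ⊥' ∷ Δ → Γ ⊢ G
  ∧L      : ∀ {Γ Δ A B G} → Γ ↭ (A ∧' B) ∷ Δ → A ∷ B ∷ Δ ⊢ G → Γ ⊢ G
  ∧R      : ∀ {Γ A B} → Γ ⊢ A → Γ ⊢ B → Γ ⊢ A ∧' B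
  ∨L      : ∀ {Γ Δ A B G} → Γ ↭ (A ∨' B) ∷ Δ → A ∷ Δ ⊢ G → B ∷ Δ ⊢ G → Γ ⊢ G
  ∨R₁     : ∀ {Γ A B} → Γ ⊢ A → Γ ⊢ A ∨' B
  ∨R₂     : ∀ {Γ A B} → Γ ⊢ B → Γ ⊢ A ∨' B
  ⇒Lax    : ∀ {Γ Δ P B G} → Atomic P → Γ ↭ P ∷ (P ⇒ B) ∷ Δ →
            P ∷ B ∷ Δ ⊢ G → Γ ⊢ G
  ⇒L⊤     : ∀ {Γ Δ B G} → Γ ↭ (⊤' ⇒ B) ∷ Δ → B ∷ Δ ⊢ G → Γ ⊢ G
  ⇒L∧     : ∀ {Γ Δ C D B G} → Γ ↭ ((C ∧' D) ⇒ B) ∷ Δ →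
            (C ⇒ B) ∷ Δ ⊢ C → (D ⇒ B) ∷ Δ ⊢ D → B ∷ Δ ⊢ G → Γ ⊢ G
  ⇒L∨₁    : ∀ {Γ Δ C D B G} → Γ ↭ ((C ∨' D) ⇒ B) ∷ Δ →
            (C ⇒ B) ∷ (D ⇒ B) ∷ Δ ⊢ C → B ∷ Δ ⊢ G → Γ ⊢ G
  ⇒L∨₂    : ∀ {Γ Δ C D B G} → Γ ↭ ((C ∨' D) ⇒ B) ∷ Δ →
            (C ⇒ B) ∷ (D ⇒ B) ∷ Δ ⊢ D → B ∷ Δ ⊢ G → Γ ⊢ G
  ⇒L⇒     : ∀ {Γ Δ C D B G} → Γ ↭ ((C ⇒ D) ⇒ B) ∷ Δ →
            (D ⇒ B) ∷ C ∷ Δ ⊢ D → B ∷ Δ ⊢ G → Γ ⊢ G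
  -- x not free in Γ, B: the context is weakened, C is the open body
  ⇒L∀     : ∀ {Γ Δ C B G} → Γ ↭ (∀' C ⇒ B) ∷ Δ →
            ↑ ((∀' C ⇒ B) ∷ Δ) ⊢ C → B ∷ Δ ⊢ G → Γ ⊢ G
  ⇒L∃     : ∀ {Γ Δ C B G} (t : Term) → Γ ↭ (∃' C ⇒ B) ∷ Δ →
            (∃' C ⇒ B) ∷ Δ ⊢ C [ t ] → B ∷ Δ ⊢ G → Γ ⊢ G
  ⇒R      : ∀ {Γ A B} → A ∷ Γ ⊢ B → Γ ⊢ A ⇒ B
  ∀R      : ∀ {Γ A} → ↑ Γ ⊢ A → Γ ⊢ ∀' A
  contr∀L : ∀ {Γ Δ A G} (t : Term) → Γ ↭ ∀' A ∷ Δ →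
            ∀' A ∷ A [ t ] ∷ Δ ⊢ G → Γ ⊢ G
  ∃L      : ∀ {Γ Δ A G} → Γ ↭ ∃' A ∷ Δ → A ∷ ↑ Δ ⊢ shiftF 0 G → Γ ⊢ G
  ∃R      : ∀ {Γ A} (t : Term) → Γ ⊢ A [ t ] → Γ ⊢ ∃' A

module Submission where

open import Defs
open import Data.Nat using (ℕ; zero; suc; pred; _≡ᵇ_; _<ᵇ_; _<_; _≤_; z≤n; s≤s; _+_)
open import Data.Nat.Properties
  using (<-cmp; ≤-refl; ≤-trans; <⇒≤; m<n⇒m<1+n; m+n≤o⇒m≤o; m+n≤o⇒n≤o; +-monoˡ-≤; m≤m+n; m≤n+m; n≤1+n)
open import Data.Bool using (true; false; if_then_else_)
open import Data.List using (List; []; _∷_; map; _++_)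
open import Data.List.Properties using (map-++)
open import Data.List.Relation.Binary.Permutation.Propositional
  using (↭-refl; ↭-sym; ↭-trans; ↭-prep; ↭-swap)
open import Data.List.Relation.Binary.Permutation.Propositional.Properties
  using (map⁺; ++⁺ˡ; shift; shifts; drop-∷; ∈-resp-↭)
open import Data.List.Membership.Propositional.Properties using (∈-∃++)
open import Data.List.Relation.Unary.Any using (here; there)
open import Data.Product using (Σ; _×_; _,_)
open import Data.Sum using (_⊎_; inj₁; inj₂)
open import Data.Empty using (⊥; ⊥-elim)
open import Function using (id; _∘_)
open import Relation.Binary using (tri<; tri≈; tri>)
open import Relation.Binary.PropositionalEquality hiding ([_])

-- (i) Renamings

lift : (ℕ → ℕ) → ℕ → ℕ
lift ρ zero = zero
lift ρ (suc x) = suc (ρ x)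

mutual
  renT : (ℕ → ℕ) → Term → Term
  renT ρ (var x) = var (ρ x)
  renT ρ (fun f ts) = fun f (renTs ρ ts)

  renTs : (ℕ → ℕ) → List Term → List Term
  renTs ρ [] = []
  renTs ρ (t ∷ ts) = renT ρ t ∷ renTs ρ ts

renF : (ℕ → ℕ) → Form → Form
renF ρ (atom p ts) = atom p (renTs ρ ts)
renF ρ ⊤' = ⊤'
renF ρ ⊥' = ⊥'
renF ρ (A ∧' B) = renF ρ A ∧' renF ρ B
renF ρ (A ∨' B) = renF ρ A ∨' renF ρ B
renF ρ (A ⇒ B) = renF ρ A ⇒ renF ρ B
renF ρ (∀' A) = ∀' (renF (lift ρ) A)
renF ρ (∃' A) = ∃' (renF (lift ρ) A)

-- Renaming a formula by the composite ρ ∘ σ equals renaming twice.  The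
-- hypothesis is stated up to pointwise equality, so that the lemma is
-- stable under lifting.
lift-comp : ∀ {ρ σ τ} → ρ ∘ σ ≗ τ → lift ρ ∘ lift σ ≗ lift τ
lift-comp e zero = refl
lift-comp e (suc x) = cong suc (e x)

mutual
  renT-comp : ∀ {ρ σ τ} → ρ ∘ σ ≗ τ → ∀ t → renT ρ (renT σ t) ≡ renT τ t
  renT-comp e (var x) = cong var (e x)
  renT-comp e (fun f ts) = cong (fun f) (renTs-comp e ts)

  renTs-comp : ∀ {ρ σ τ} → ρ ∘ σ ≗ τ → ∀ ts → renTs ρ (renTs σ ts) ≡ renTs τ ts
  renTs-comp e [] = refl
  renTs-comp e (t ∷ ts) = cong₂ _∷_ (renT-comp e t) (renTs-comp e ts)

renF-comp : ∀ {ρ σ τ} → ρ ∘ σ ≗ τ → ∀ A → renF ρ (renF σ A) ≡ renF τ A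
renF-comp e (atom p ts) = cong (atom p) (renTs-comp e ts)
renF-comp e ⊤' = refl
renF-comp e ⊥' = refl
renF-comp e (A ∧' B) = cong₂ _∧'_ (renF-comp e A) (renF-comp e B)
renF-comp e (A ∨' B) = cong₂ _∨'_ (renF-comp e A) (renF-comp e B)
renF-comp e (A ⇒ B) = cong₂ _⇒_ (renF-comp e A) (renF-comp e B)
renF-comp e (∀' A) = cong ∀' (renF-comp (lift-comp e) A)
renF-comp e (∃' A) = cong ∃' (renF-comp (lift-comp e) A)

lift-id : ∀ {ρ} → ρ ≗ id → lift ρ ≗ id
lift-id e zero = refl
lift-id e (suc x) = cong suc (e x)

mutual
  renT-id : ∀ {ρ} → ρ ≗ id → ∀ t → renT ρ t ≡ t
  renT-id e (var x) = cong var (e x)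
  renT-id e (fun f ts) = cong (fun f) (renTs-id e ts)

  renTs-id : ∀ {ρ} → ρ ≗ id → ∀ ts → renTs ρ ts ≡ ts
  renTs-id e [] = refl
  renTs-id e (t ∷ ts) = cong₂ _∷_ (renT-id e t) (renTs-id e ts)

renF-id : ∀ {ρ} → ρ ≗ id → ∀ A → renF ρ A ≡ A
renF-id e (atom p ts) = cong (atom p) (renTs-id e ts)
renF-id e ⊤' = refl
renF-id e ⊥' = refl
renF-id e (A ∧' B) = cong₂ _∧'_ (renF-id e A) (renF-id e B)
renF-id e (A ∨' B) = cong₂ _∨'_ (renF-id e A) (renF-id e B)
renF-id e (A ⇒ B) = cong₂ _⇒_ (renF-id e A) (renF-id e B)
renF-id e (∀' A) = cong ∀' (renF-id (lift-id e) A)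
renF-id e (∃' A) = cong ∃' (renF-id (lift-id e) A)

shiftVar : ℕ → ℕ → ℕ
shiftVar c x = if x <ᵇ c then x else suc x

lift-shiftVar : ∀ c {ρ} → ρ ≗ shiftVar c → lift ρ ≗ shiftVar (suc c)
lift-shiftVar c e zero = refl
lift-shiftVar c e (suc x) rewrite e x with x <ᵇ c
... | true = refl
... | false = refl

mutual
  shiftT-ren : ∀ c {ρ} → ρ ≗ shiftVar c → ∀ t → shiftT c t ≡ renT ρ t
  shiftT-ren c e (var x) rewrite e x with x <ᵇ c
  ... | true = refl
  ... | false = refl
  shiftT-ren c e (fun f ts) = cong (fun f) (shiftTs-ren c e ts)

  shiftTs-ren : ∀ c {ρ} → ρ ≗ shiftVar c → ∀ ts → shiftTs c ts ≡ renTs ρ ts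
  shiftTs-ren c e [] = refl
  shiftTs-ren c e (t ∷ ts) = cong₂ _∷_ (shiftT-ren c e t) (shiftTs-ren c e ts)

shiftF-ren : ∀ c {ρ} → ρ ≗ shiftVar c → ∀ A → shiftF c A ≡ renF ρ A
shiftF-ren c e (atom p ts) = cong (atom p) (shiftTs-ren c e ts)
shiftF-ren c e ⊤' = refl
shiftF-ren c e ⊥' = refl
shiftF-ren c e (A ∧' B) = cong₂ _∧'_ (shiftF-ren c e A) (shiftF-ren c e B)
shiftF-ren c e (A ∨' B) = cong₂ _∨'_ (shiftF-ren c e A) (shiftF-ren c e B)
shiftF-ren c e (A ⇒ B) = cong₂ _⇒_ (shiftF-ren c e A) (shiftF-ren c e B)
shiftF-ren c e (∀' A) = cong ∀' (shiftF-ren (suc c) (lift-shiftVar c e) A)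
shiftF-ren c e (∃' A) = cong ∃' (shiftF-ren (suc c) (lift-shiftVar c e) A)

shift₀-ren : ∀ A → shiftF 0 A ≡ renF suc A
shift₀-ren = shiftF-ren 0 (λ _ → refl)

shift₁-ren : ∀ A → shiftF 1 A ≡ renF (lift suc) A
shift₁-ren = shiftF-ren 1 λ { zero → refl ; (suc x) → refl }

shiftT₀-ren : ∀ t → shiftT 0 t ≡ renT suc t
shiftT₀-ren = shiftT-ren 0 (λ _ → refl)

ren-shift₀ : ∀ {ρ τ} → ρ ∘ suc ≗ τ → ∀ A → renF ρ (shiftF 0 A) ≡ renF τ A
ren-shift₀ {ρ} e A = trans (cong (renF ρ) (shift₀-ren A)) (renF-comp e A)

ren-shift₁ : ∀ {ρ τ} → ρ ∘ lift suc ≗ τ → ∀ A → renF ρ (shiftF 1 A) ≡ renF τ A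
ren-shift₁ {ρ} e A = trans (cong (renF ρ) (shift₁-ren A)) (renF-comp e A)

renT-lift-shift : ∀ ρ t → renT (lift ρ) (shiftT 0 t) ≡ shiftT 0 (renT ρ t)
renT-lift-shift ρ t = begin
    renT (lift ρ) (shiftT 0 t) ≡⟨ cong (renT (lift ρ)) (shiftT₀-ren t) ⟩
    renT (lift ρ) (renT suc t) ≡⟨ renT-comp (λ _ → refl) t ⟩
    renT (suc ∘ ρ) t           ≡⟨ sym (renT-comp (λ _ → refl) t) ⟩
    renT suc (renT ρ t)        ≡⟨ sym (shiftT₀-ren (renT ρ t)) ⟩
    shiftT 0 (renT ρ t)        ∎
  where open ≡-Reasoning

renF-lift-shift : ∀ ρ A → renF (lift ρ) (shiftF 0 A) ≡ shiftF 0 (renF ρ A)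
renF-lift-shift ρ A = begin
    renF (lift ρ) (shiftF 0 A) ≡⟨ ren-shift₀ (λ _ → refl) A ⟩
    renF (suc ∘ ρ) A           ≡⟨ sym (renF-comp (λ _ → refl) A) ⟩
    renF suc (renF ρ A)        ≡⟨ sym (shift₀-ren (renF ρ A)) ⟩
    shiftF 0 (renF ρ A)        ∎
  where open ≡-Reasoning

renF-↑ : ∀ ρ Γ → map (renF (lift ρ)) (↑ Γ) ≡ ↑ (map (renF ρ) Γ)
renF-↑ ρ [] = refl
renF-↑ ρ (A ∷ Γ) = cong₂ _∷_ (renF-lift-shift ρ A) (renF-↑ ρ Γ)

liftⁿ : ℕ → (ℕ → ℕ) → ℕ → ℕ
liftⁿ zero ρ = ρ
liftⁿ (suc k) ρ = lift (liftⁿ k ρ)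

liftⁿ-below : ∀ k ρ {x} → x < k → liftⁿ k ρ x ≡ x
liftⁿ-below (suc k) ρ {zero} p = refl
liftⁿ-below (suc k) ρ {suc x} (s≤s p) = cong suc (liftⁿ-below k ρ p)

liftⁿ-above : ∀ k ρ {y} → k ≤ y → k ≤ liftⁿ k ρ y
liftⁿ-above zero ρ p = z≤n
liftⁿ-above (suc k) ρ {suc y} (s≤s p) = s≤s (liftⁿ-above k ρ p)

≡ᵇ-refl : ∀ k → (k ≡ᵇ k) ≡ true
≡ᵇ-refl zero = refl
≡ᵇ-refl (suc k) = ≡ᵇ-refl k

≡ᵇ-< : ∀ {x k} → x < k → (x ≡ᵇ k) ≡ false
≡ᵇ-< {zero} {suc k} _ = refl
≡ᵇ-< {suc x} {suc k} (s≤s p) = ≡ᵇ-< p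

≡ᵇ-> : ∀ {x k} → k < x → (x ≡ᵇ k) ≡ false
≡ᵇ-> {suc x} {zero} _ = refl
≡ᵇ-> {suc x} {suc k} (s≤s p) = ≡ᵇ-> p

<ᵇ-< : ∀ {x k} → x < k → (x <ᵇ k) ≡ true
<ᵇ-< {zero} {suc k} _ = refl
<ᵇ-< {suc x} {suc k} (s≤s p) = <ᵇ-< p

<ᵇ-≥ : ∀ {x k} → k ≤ x → (x <ᵇ k) ≡ false
<ᵇ-≥ {x} {zero} _ = refl
<ᵇ-≥ {suc x} {suc k} (s≤s p) = <ᵇ-≥ p

substT-below : ∀ {k s x} → x < k → substT k s (var x) ≡ var x
substT-below p rewrite ≡ᵇ-< p | <ᵇ-< p = refl

substT-at : ∀ k s → substT k s (var k) ≡ s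
substT-at k s rewrite ≡ᵇ-refl k = refl

substT-above : ∀ {k s x} → k < x → substT k s (var x) ≡ var (pred x)
substT-above p rewrite ≡ᵇ-> p | <ᵇ-≥ (<⇒≤ p) = refl

renT-substT-var : ∀ k ρ s x →
  renT (liftⁿ k ρ) (substT k s (var x)) ≡ substT k (renT (liftⁿ k ρ) s) (var (liftⁿ (suc k) ρ x))
renT-substT-var k ρ s x with <-cmp x k
... | tri< p _ _
  rewrite substT-below {k} {s} p | liftⁿ-below (suc k) ρ (m<n⇒m<1+n p) | substT-below {k} {renT (liftⁿ k ρ) s} p
  = cong var (liftⁿ-below k ρ p)
... | tri≈ _ refl _
  rewrite substT-at k s | liftⁿ-below (suc k) ρ {k} (s≤s ≤-refl) | substT-at k (renT (liftⁿ k ρ) s)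
  = refl
renT-substT-var k ρ s (suc y) | tri> _ _ (s≤s p)
  rewrite substT-above {k} {s} (s≤s p) | substT-above {k} {renT (liftⁿ k ρ) s} (s≤s (liftⁿ-above k ρ p))
  = refl

mutual
  renT-substT : ∀ k ρ s t →
    renT (liftⁿ k ρ) (substT k s t) ≡ substT k (renT (liftⁿ k ρ) s) (renT (liftⁿ (suc k) ρ) t)
  renT-substT k ρ s (var x) = renT-substT-var k ρ s x
  renT-substT k ρ s (fun f ts) = cong (fun f) (renTs-substTs k ρ s ts)

  renTs-substTs : ∀ k ρ s ts →
    renTs (liftⁿ k ρ) (substTs k s ts) ≡ substTs k (renT (liftⁿ k ρ) s) (renTs (liftⁿ (suc k) ρ) ts)
  renTs-substTs k ρ s [] = refl
  renTs-substTs k ρ s (t ∷ ts) = cong₂ _∷_ (renT-substT k ρ s t) (renTs-substTs k ρ s ts)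

-- Under a binder the substituted term is shifted; shifting commutes with ρ.
renF-substF-binder : ∀ k ρ s A →
  renF (liftⁿ (suc k) ρ) (substF (suc k) (shiftT 0 s) A)
    ≡ substF (suc k) (shiftT 0 (renT (liftⁿ k ρ) s)) (renF (liftⁿ (suc (suc k)) ρ) A)

renF-substF : ∀ k ρ s A →
  renF (liftⁿ k ρ) (substF k s A) ≡ substF k (renT (liftⁿ k ρ) s) (renF (liftⁿ (suc k) ρ) A)
renF-substF k ρ s (atom p ts) = cong (atom p) (renTs-substTs k ρ s ts)
renF-substF k ρ s ⊤' = refl
renF-substF k ρ s ⊥' = refl
renF-substF k ρ s (A ∧' B) = cong₂ _∧'_ (renF-substF k ρ s A) (renF-substF k ρ s B)
renF-substF k ρ s (A ∨' B) = cong₂ _∨'_ (renF-substF k ρ s A) (renF-substF k ρ s B)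
renF-substF k ρ s (A ⇒ B) = cong₂ _⇒_ (renF-substF k ρ s A) (renF-substF k ρ s B)
renF-substF k ρ s (∀' A) = cong ∀' (renF-substF-binder k ρ s A)
renF-substF k ρ s (∃' A) = cong ∃' (renF-substF-binder k ρ s A)

renF-substF-binder k ρ s A =
  trans (renF-substF (suc k) ρ (shiftT 0 s) A)
        (cong (λ u → substF (suc k) u (renF (liftⁿ (suc (suc k)) ρ) A)) (renT-lift-shift (liftⁿ k ρ) s))

renF-[] : ∀ ρ A t → renF ρ (A [ t ]) ≡ (renF (lift ρ) A) [ renT ρ t ]
renF-[] ρ A t = renF-substF 0 ρ t A

-- (ii) Two presentations of one context

∷-↭-∷ : ∀ {X Y : Form} {Δ Ψ} → X ∷ Δ ↭ Y ∷ Ψ →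
        (X ≡ Y × Δ ↭ Ψ) ⊎ Σ (List Form) (λ Ψ' → Ψ ↭ X ∷ Ψ' × Δ ↭ Y ∷ Ψ')
∷-↭-∷ {X} {Y} {Δ} {Ψ} p with ∈-resp-↭ (↭-sym p) (here refl)
... | here refl = inj₁ (refl , drop-∷ p)
... | there m with ∈-∃++ m
... | Δ₁ , Δ₂ , refl = inj₂ (Δ₁ ++ Δ₂ , drop-∷ (↭-trans (↭-sym p) swapped) , shift Y Δ₁ Δ₂)
  where
  swapped : X ∷ Δ₁ ++ Y ∷ Δ₂ ↭ Y ∷ X ∷ Δ₁ ++ Δ₂
  swapped = ↭-trans (↭-prep X (shift Y Δ₁ Δ₂)) (↭-swap X Y ↭-refl)

principal-cases : ∀ {Γ F Δ X Θ} → Γ ↭ F ∷ Δ → Γ ↭ X ∷ Θ →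
                  (F ≡ X × Δ ↭ Θ) ⊎ Σ (List Form) (λ Θ' → Θ ↭ F ∷ Θ' × Δ ↭ X ∷ Θ')
principal-cases p q = ∷-↭-∷ (↭-trans (↭-sym p) q)

principal-cases₂ : ∀ {Γ F Δ A Θ} → Γ ↭ F ∷ Δ → Γ ↭ A ∷ A ∷ Θ →
                   (F ≡ A × Δ ↭ A ∷ Θ) ⊎ Σ (List Form) (λ Θ' → Θ ↭ F ∷ Θ' × Δ ↭ A ∷ A ∷ Θ')
principal-cases₂ {A = A} p q with principal-cases p q
... | inj₁ same = inj₁ same
... | inj₂ (Ψ , q₁ , q₂) with ∷-↭-∷ q₁
...   | inj₁ (refl , r) = inj₁ (refl , ↭-trans q₂ (↭-prep A (↭-sym r)))
...   | inj₂ (Ψ' , r₁ , r₂) = inj₂ (Ψ' , r₂ , ↭-trans q₂ (↭-prep A r₁))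

to-front : ∀ (E : List Form) {Δ X Θ} → Δ ↭ X ∷ Θ → E ++ Δ ↭ X ∷ E ++ Θ
to-front E {X = X} {Θ} p = ↭-trans (++⁺ˡ E p) (shift X E Θ)

to-front₁ : ∀ (Y : Form) {Δ X Θ} → Δ ↭ X ∷ Θ → Y ∷ Δ ↭ X ∷ Y ∷ Θ
to-front₁ Y = to-front (Y ∷ [])

to-front₂ : ∀ (E : List Form) {Δ A Θ} → Δ ↭ A ∷ A ∷ Θ → E ++ Δ ↭ A ∷ A ∷ E ++ Θ
to-front₂ E {A = A} q = ↭-trans (++⁺ˡ E q) (shifts E (A ∷ A ∷ []))

to-front-↑ : ∀ (A : Form) {Θ F Θ'} → Θ ↭ F ∷ Θ' → A ∷ ↑ Θ ↭ shiftF 0 F ∷ A ∷ ↑ Θ'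
to-front-↑ A q = to-front₁ A (map⁺ (shiftF 0) q)

-- (iii) Structural rules

exchange : ∀ {Γ Γ' G} → Γ ⊢ G → Γ ↭ Γ' → Γ' ⊢ G
exchange (ax a p) q = ax a (↭-trans (↭-sym q) p)
exchange ⊤R q = ⊤R
exchange (⊥L p) q = ⊥L (↭-trans (↭-sym q) p)
exchange (∧L p d) q = ∧L (↭-trans (↭-sym q) p) d
exchange (∧R d e) q = ∧R (exchange d q) (exchange e q)
exchange (∨L p d e) q = ∨L (↭-trans (↭-sym q) p) d e
exchange (∨R₁ d) q = ∨R₁ (exchange d q)
exchange (∨R₂ d) q = ∨R₂ (exchange d q)
exchange (⇒Lax a p d) q = ⇒Lax a (↭-trans (↭-sym q) p) d
exchange (⇒L⊤ p d) q = ⇒L⊤ (↭-trans (↭-sym q) p) d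
exchange (⇒L∧ p d₁ d₂ d₃) q = ⇒L∧ (↭-trans (↭-sym q) p) d₁ d₂ d₃
exchange (⇒L∨₁ p d₁ d₂) q = ⇒L∨₁ (↭-trans (↭-sym q) p) d₁ d₂
exchange (⇒L∨₂ p d₁ d₂) q = ⇒L∨₂ (↭-trans (↭-sym q) p) d₁ d₂
exchange (⇒L⇒ p d₁ d₂) q = ⇒L⇒ (↭-trans (↭-sym q) p) d₁ d₂
exchange (⇒L∀ p d₁ d₂) q = ⇒L∀ (↭-trans (↭-sym q) p) d₁ d₂
exchange (⇒L∃ t p d₁ d₂) q = ⇒L∃ t (↭-trans (↭-sym q) p) d₁ d₂
exchange (⇒R d) q = ⇒R (exchange d (↭-prep _ q))
exchange (∀R d) q = ∀R (exchange d (map⁺ (shiftF 0) q))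
exchange (contr∀L t p d) q = contr∀L t (↭-trans (↭-sym q) p) d
exchange (∃L p d) q = ∃L (↭-trans (↭-sym q) p) d
exchange (∃R t d) q = ∃R t (exchange d q)

swap-head : ∀ {X Y Γ G} → X ∷ Y ∷ Γ ⊢ G → Y ∷ X ∷ Γ ⊢ G
swap-head d = exchange d (↭-swap _ _ ↭-refl)

renF-atomic : ∀ ρ {P} → Atomic P → Atomic (renF ρ P)
renF-atomic ρ (atomic p ts) = atomic p _

rename : ∀ ρ {Γ G} → Γ ⊢ G → map (renF ρ) Γ ⊢ renF ρ G
rename ρ (ax a p) = ax (renF-atomic ρ a) (map⁺ _ p)
rename ρ ⊤R = ⊤R
rename ρ (⊥L p) = ⊥L (map⁺ _ p)
rename ρ (∧L p d) = ∧L (map⁺ _ p) (rename ρ d)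
rename ρ (∧R d e) = ∧R (rename ρ d) (rename ρ e)
rename ρ (∨L p d e) = ∨L (map⁺ _ p) (rename ρ d) (rename ρ e)
rename ρ (∨R₁ d) = ∨R₁ (rename ρ d)
rename ρ (∨R₂ d) = ∨R₂ (rename ρ d)
rename ρ (⇒Lax a p d) = ⇒Lax (renF-atomic ρ a) (map⁺ _ p) (rename ρ d)
rename ρ (⇒L⊤ p d) = ⇒L⊤ (map⁺ _ p) (rename ρ d)
rename ρ (⇒L∧ p d₁ d₂ d₃) = ⇒L∧ (map⁺ _ p) (rename ρ d₁) (rename ρ d₂) (rename ρ d₃)
rename ρ (⇒L∨₁ p d₁ d₂) = ⇒L∨₁ (map⁺ _ p) (rename ρ d₁) (rename ρ d₂)
rename ρ (⇒L∨₂ p d₁ d₂) = ⇒L∨₂ (map⁺ _ p) (rename ρ d₁) (rename ρ d₂)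
rename ρ (⇒L⇒ p d₁ d₂) = ⇒L⇒ (map⁺ _ p) (rename ρ d₁) (rename ρ d₂)
rename ρ (⇒L∀ {Δ = Δ} {C} {B} p d₁ d₂) =
  ⇒L∀ (map⁺ _ p) (subst (_⊢ renF (lift ρ) C) (renF-↑ ρ ((∀' C ⇒ B) ∷ Δ)) (rename (lift ρ) d₁)) (rename ρ d₂)
rename ρ (⇒L∃ {C = C} t p d₁ d₂) =
  ⇒L∃ (renT ρ t) (map⁺ _ p) (subst (_ ⊢_) (renF-[] ρ C t) (rename ρ d₁)) (rename ρ d₂)
rename ρ (⇒R d) = ⇒R (rename ρ d)
rename ρ (∀R {Γ} {A} d) = ∀R (subst (_⊢ renF (lift ρ) A) (renF-↑ ρ Γ) (rename (lift ρ) d))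
rename ρ (contr∀L {Δ = Δ} {A} {G} t p d) =
  contr∀L (renT ρ t) (map⁺ _ p)
    (subst (λ Z → _ ∷ Z ∷ map (renF ρ) Δ ⊢ renF ρ G) (renF-[] ρ A t) (rename ρ d))
rename ρ (∃L {Δ = Δ} {A} {G} p d) =
  ∃L (map⁺ _ p)
    (subst₂ (λ Z W → renF (lift ρ) A ∷ Z ⊢ W) (renF-↑ ρ Δ) (renF-lift-shift ρ G) (rename (lift ρ) d))
rename ρ (∃R {A = A} t d) = ∃R (renT ρ t) (subst (_ ⊢_) (renF-[] ρ A t) (rename ρ d))

weaken : ∀ (X : Form) {Γ G} → Γ ⊢ G → X ∷ Γ ⊢ G
weaken X (ax a p) = ax a (to-front₁ X p)
weaken X ⊤R = ⊤R
weaken X (⊥L p) = ⊥L (to-front₁ X p)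
weaken X (∧L {A = A} {B} p d) =
  ∧L (to-front₁ X p) (exchange (weaken X d) (shifts (X ∷ []) (A ∷ B ∷ [])))
weaken X (∧R d e) = ∧R (weaken X d) (weaken X e)
weaken X (∨L p d e) = ∨L (to-front₁ X p) (swap-head (weaken X d)) (swap-head (weaken X e))
weaken X (∨R₁ d) = ∨R₁ (weaken X d)
weaken X (∨R₂ d) = ∨R₂ (weaken X d)
weaken X (⇒Lax {P = P} {B} a p d) =
  ⇒Lax a (↭-trans (to-front₁ X p) (↭-prep P (↭-swap X _ ↭-refl)))
    (exchange (weaken X d) (shifts (X ∷ []) (P ∷ B ∷ [])))
weaken X (⇒L⊤ p d) = ⇒L⊤ (to-front₁ X p) (swap-head (weaken X d))
weaken X (⇒L∧ p d₁ d₂ d₃) =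
  ⇒L∧ (to-front₁ X p) (swap-head (weaken X d₁)) (swap-head (weaken X d₂)) (swap-head (weaken X d₃))
weaken X (⇒L∨₁ {C = C} {D} {B} p d₁ d₂) =
  ⇒L∨₁ (to-front₁ X p) (exchange (weaken X d₁) (shifts (X ∷ []) ((C ⇒ B) ∷ (D ⇒ B) ∷ [])))
    (swap-head (weaken X d₂))
weaken X (⇒L∨₂ {C = C} {D} {B} p d₁ d₂) =
  ⇒L∨₂ (to-front₁ X p) (exchange (weaken X d₁) (shifts (X ∷ []) ((C ⇒ B) ∷ (D ⇒ B) ∷ [])))
    (swap-head (weaken X d₂))
weaken X (⇒L⇒ {C = C} {D} {B} p d₁ d₂) =
  ⇒L⇒ (to-front₁ X p) (exchange (weaken X d₁) (shifts (X ∷ []) ((D ⇒ B) ∷ C ∷ [])))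
    (swap-head (weaken X d₂))
weaken X (⇒L∀ p d₁ d₂) =
  ⇒L∀ (to-front₁ X p) (swap-head (weaken (shiftF 0 X) d₁)) (swap-head (weaken X d₂))
weaken X (⇒L∃ t p d₁ d₂) = ⇒L∃ t (to-front₁ X p) (swap-head (weaken X d₁)) (swap-head (weaken X d₂))
weaken X (⇒R d) = ⇒R (swap-head (weaken X d))
weaken X (∀R d) = ∀R (weaken (shiftF 0 X) d)
weaken X (contr∀L {A = A} t p d) =
  contr∀L t (to-front₁ X p) (exchange (weaken X d) (shifts (X ∷ []) (∀' A ∷ (A [ t ]) ∷ [])))
weaken X (∃L p d) = ∃L (to-front₁ X p) (swap-head (weaken (shiftF 0 X) d))
weaken X (∃R t d) = ∃R t (weaken X d)

-- (iv) Inversion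

-- The premises of a left rule of D whose principal formula is X, read in
-- the context X ∷ Θ.  (Atoms are never principal: they are only used, by
-- the axiom and by ⇒-left_axiom.)
data Principal : Form → List Form → Form → Set where
  ⊥L   : ∀ {Θ G} → Principal ⊥' Θ G
  ∧L   : ∀ {A B Θ G} → A ∷ B ∷ Θ ⊢ G → Principal (A ∧' B) Θ G
  ∨L   : ∀ {A B Θ G} → A ∷ Θ ⊢ G → B ∷ Θ ⊢ G → Principal (A ∨' B) Θ G
  ⇒Lax : ∀ {P B Θ Θ₁ G} → Atomic P → Θ ↭ P ∷ Θ₁ → P ∷ B ∷ Θ₁ ⊢ G → Principal (P ⇒ B) Θ G
  ⇒L⊤  : ∀ {B Θ G} → B ∷ Θ ⊢ G → Principal (⊤' ⇒ B) Θ G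
  ⇒L∧  : ∀ {C D B Θ G} → (C ⇒ B) ∷ Θ ⊢ C → (D ⇒ B) ∷ Θ ⊢ D → B ∷ Θ ⊢ G →
         Principal ((C ∧' D) ⇒ B) Θ G
  ⇒L∨₁ : ∀ {C D B Θ G} → (C ⇒ B) ∷ (D ⇒ B) ∷ Θ ⊢ C → B ∷ Θ ⊢ G → Principal ((C ∨' D) ⇒ B) Θ G
  ⇒L∨₂ : ∀ {C D B Θ G} → (C ⇒ B) ∷ (D ⇒ B) ∷ Θ ⊢ D → B ∷ Θ ⊢ G → Principal ((C ∨' D) ⇒ B) Θ G
  ⇒L⇒  : ∀ {C D B Θ G} → (D ⇒ B) ∷ C ∷ Θ ⊢ D → B ∷ Θ ⊢ G → Principal ((C ⇒ D) ⇒ B) Θ G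
  ⇒L∀  : ∀ {C B Θ G} → ↑ ((∀' C ⇒ B) ∷ Θ) ⊢ C → B ∷ Θ ⊢ G → Principal (∀' C ⇒ B) Θ G
  ⇒L∃  : ∀ {C B Θ G} (t : Term) → (∃' C ⇒ B) ∷ Θ ⊢ C [ t ] → B ∷ Θ ⊢ G → Principal (∃' C ⇒ B) Θ G
  ∀L   : ∀ {A Θ G} (t : Term) → ∀' A ∷ A [ t ] ∷ Θ ⊢ G → Principal (∀' A) Θ G
  ∃L   : ∀ {A Θ G} → A ∷ ↑ Θ ⊢ shiftF 0 G → Principal (∃' A) Θ G

record Simulable (R : Form → List Form → Set) : Set₁ where
  field
    compound     : ∀ {X Ys} → R X Ys → Atomic X → ⊥
    shift-stable : ∀ {X Ys} → R X Ys → R (shiftF 0 X) (↑ Ys)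
    replay       : ∀ {X Ys Θ G} → R X Ys → Principal X Θ G → Ys ++ Θ ⊢ G

-- Rules not acting
-- on X commute with the transformation; rules acting on X are replayed.
module _ {R : Form → List Form → Set} (S : Simulable R) where
  open Simulable S

  invert : ∀ {Γ G X Ys Θ} → Γ ⊢ G → Γ ↭ X ∷ Θ → R X Ys → Ys ++ Θ ⊢ G

  invert-under : ∀ (E : List Form) {Δ G X Ys Θ} → E ++ Δ ⊢ G → Δ ↭ X ∷ Θ → R X Ys → E ++ Ys ++ Θ ⊢ G
  invert-under E {Ys = Ys} d p r = exchange (invert d (to-front E p) r) (shifts Ys E)

  invert-↑ : ∀ (E : List Form) {Δ G X Ys Θ} → E ++ ↑ Δ ⊢ G → Δ ↭ X ∷ Θ → R X Ys → E ++ ↑ (Ys ++ Θ) ⊢ G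
  invert-↑ E {G = G} {Ys = Ys} {Θ} d p r =
    subst (λ Z → E ++ Z ⊢ G) (sym (map-++ (shiftF 0) Ys Θ))
      (exchange (invert d (to-front E (map⁺ (shiftF 0) p)) (shift-stable r)) (shifts (↑ Ys) E))

  invert (ax a p) q r with principal-cases p q
  ... | inj₁ (refl , _) = ⊥-elim (compound r a)
  ... | inj₂ (_ , q₁ , _) = ax a (to-front _ q₁)
  invert ⊤R q r = ⊤R
  invert (⊥L p) q r with principal-cases p q
  ... | inj₁ (refl , _) = replay r ⊥L
  ... | inj₂ (_ , q₁ , _) = ⊥L (to-front _ q₁)
  invert (∧L {A = A} {B} p d) q r with principal-cases p q
  ... | inj₁ (refl , q') = replay r (∧L (exchange d (↭-prep A (↭-prep B q'))))
  ... | inj₂ (_ , q₁ , q₂) = ∧L (to-front _ q₁) (invert-under (A ∷ B ∷ []) d q₂ r)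
  invert (∧R d e) q r = ∧R (invert d q r) (invert e q r)
  invert (∨L {A = A} {B} p d e) q r with principal-cases p q
  ... | inj₁ (refl , q') = replay r (∨L (exchange d (↭-prep A q')) (exchange e (↭-prep B q')))
  ... | inj₂ (_ , q₁ , q₂) = ∨L (to-front _ q₁) (invert-under (A ∷ []) d q₂ r) (invert-under (B ∷ []) e q₂ r)
  invert (∨R₁ d) q r = ∨R₁ (invert d q r)
  invert (∨R₂ d) q r = ∨R₂ (invert d q r)
  invert {Ys = Ys} (⇒Lax {P = P} {B} a p d) q r with principal-cases p q
  ... | inj₁ (refl , _) = ⊥-elim (compound r a)
  ... | inj₂ (_ , q₁ , q₂) with ∷-↭-∷ q₂
  ...   | inj₁ (refl , q₃) = replay r (⇒Lax a q₁ (exchange d (↭-prep P (↭-prep B q₃))))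
  ...   | inj₂ (_ , q₃ , q₄) =
          ⇒Lax a (↭-trans (to-front Ys q₁) (↭-prep P (to-front Ys q₃))) (invert-under (P ∷ B ∷ []) d q₄ r)
  invert (⇒L⊤ {B = B} p d) q r with principal-cases p q
  ... | inj₁ (refl , q') = replay r (⇒L⊤ (exchange d (↭-prep B q')))
  ... | inj₂ (_ , q₁ , q₂) = ⇒L⊤ (to-front _ q₁) (invert-under (B ∷ []) d q₂ r)
  invert (⇒L∧ {C = C} {D} {B} p d₁ d₂ d₃) q r with principal-cases p q
  ... | inj₁ (refl , q') =
        replay r (⇒L∧ (exchange d₁ (↭-prep _ q')) (exchange d₂ (↭-prep _ q')) (exchange d₃ (↭-prep _ q')))
  ... | inj₂ (_ , q₁ , q₂) =
        ⇒L∧ (to-front _ q₁) (invert-under ((C ⇒ B) ∷ []) d₁ q₂ r) (invert-under ((D ⇒ B) ∷ []) d₂ q₂ r)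
          (invert-under (B ∷ []) d₃ q₂ r)
  invert (⇒L∨₁ {C = C} {D} {B} p d₁ d₂) q r with principal-cases p q
  ... | inj₁ (refl , q') = replay r (⇒L∨₁ (exchange d₁ (↭-prep _ (↭-prep _ q'))) (exchange d₂ (↭-prep _ q')))
  ... | inj₂ (_ , q₁ , q₂) =
        ⇒L∨₁ (to-front _ q₁) (invert-under ((C ⇒ B) ∷ (D ⇒ B) ∷ []) d₁ q₂ r) (invert-under (B ∷ []) d₂ q₂ r)
  invert (⇒L∨₂ {C = C} {D} {B} p d₁ d₂) q r with principal-cases p q
  ... | inj₁ (refl , q') = replay r (⇒L∨₂ (exchange d₁ (↭-prep _ (↭-prep _ q'))) (exchange d₂ (↭-prep _ q')))
  ... | inj₂ (_ , q₁ , q₂) =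
        ⇒L∨₂ (to-front _ q₁) (invert-under ((C ⇒ B) ∷ (D ⇒ B) ∷ []) d₁ q₂ r) (invert-under (B ∷ []) d₂ q₂ r)
  invert (⇒L⇒ {C = C} {D} {B} p d₁ d₂) q r with principal-cases p q
  ... | inj₁ (refl , q') = replay r (⇒L⇒ (exchange d₁ (↭-prep _ (↭-prep _ q'))) (exchange d₂ (↭-prep _ q')))
  ... | inj₂ (_ , q₁ , q₂) =
        ⇒L⇒ (to-front _ q₁) (invert-under ((D ⇒ B) ∷ C ∷ []) d₁ q₂ r) (invert-under (B ∷ []) d₂ q₂ r)
  invert (⇒L∀ {C = C} {B} p d₁ d₂) q r with principal-cases p q
  ... | inj₁ (refl , q') = replay r
        (⇒L∀ (exchange d₁ (map⁺ (shiftF 0) (↭-prep _ q'))) (exchange d₂ (↭-prep _ q')))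
  ... | inj₂ (_ , q₁ , q₂) =
        ⇒L∀ (to-front _ q₁) (invert-↑ (shiftF 0 (∀' C ⇒ B) ∷ []) d₁ q₂ r) (invert-under (B ∷ []) d₂ q₂ r)
  invert (⇒L∃ {C = C} {B} t p d₁ d₂) q r with principal-cases p q
  ... | inj₁ (refl , q') = replay r (⇒L∃ t (exchange d₁ (↭-prep _ q')) (exchange d₂ (↭-prep _ q')))
  ... | inj₂ (_ , q₁ , q₂) =
        ⇒L∃ t (to-front _ q₁) (invert-under ((∃' C ⇒ B) ∷ []) d₁ q₂ r) (invert-under (B ∷ []) d₂ q₂ r)
  invert (⇒R {A = A} d) q r = ⇒R (invert-under (A ∷ []) d q r)
  invert (∀R d) q r = ∀R (invert-↑ [] d q r)
  invert (contr∀L {A = A} t p d) q r with principal-cases p q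
  ... | inj₁ (refl , q') = replay r (∀L t (exchange d (↭-prep _ (↭-prep _ q'))))
  ... | inj₂ (_ , q₁ , q₂) = contr∀L t (to-front _ q₁) (invert-under (∀' A ∷ (A [ t ]) ∷ []) d q₂ r)
  invert (∃L {A = A} p d) q r with principal-cases p q
  ... | inj₁ (refl , q') = replay r (∃L (exchange d (↭-prep _ (map⁺ (shiftF 0) q'))))
  ... | inj₂ (_ , q₁ , q₂) = ∃L (to-front _ q₁) (invert-↑ (A ∷ []) d q₂ r)
  invert (∃R t d) q r = ∃R t (invert d q r)

data ∧-parts : Form → List Form → Set where
  both : ∀ {A B} → ∧-parts (A ∧' B) (A ∷ B ∷ [])

invert-∧ : ∀ {Γ G A B Θ} → Γ ⊢ G → Γ ↭ (A ∧' B) ∷ Θ → A ∷ B ∷ Θ ⊢ G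
invert-∧ d p = invert simulable d p both
  where
  simulable : Simulable ∧-parts
  simulable = record
    { compound = λ { both () }
    ; shift-stable = λ { both → both }
    ; replay = λ { both (∧L d) → d } }

data ∨-part : Form → List Form → Set where
  left  : ∀ {A B} → ∨-part (A ∨' B) (A ∷ [])
  right : ∀ {A B} → ∨-part (A ∨' B) (B ∷ [])

∨-simulable : Simulable ∨-part
∨-simulable = record
  { compound = λ { left () ; right () }
  ; shift-stable = λ { left → left ; right → right }
  ; replay = λ { left (∨L d e) → d ; right (∨L d e) → e } }

invert-∨₁ : ∀ {Γ G A B Θ} → Γ ⊢ G → Γ ↭ (A ∨' B) ∷ Θ → A ∷ Θ ⊢ G
invert-∨₁ d p = invert ∨-simulable d p left

invert-∨₂ : ∀ {Γ G A B Θ} → Γ ⊢ G → Γ ↭ (A ∨' B) ∷ Θ → B ∷ Θ ⊢ G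
invert-∨₂ d p = invert ∨-simulable d p right

data consequent : Form → List Form → Set where
  conseq : ∀ {A B} → consequent (A ⇒ B) (B ∷ [])

invert-⇒-conseq : ∀ {Γ G A B Θ} → Γ ⊢ G → Γ ↭ (A ⇒ B) ∷ Θ → B ∷ Θ ⊢ G
invert-⇒-conseq d p = invert simulable d p conseq
  where
  simulable : Simulable consequent
  simulable = record
    { compound = λ { conseq () }
    ; shift-stable = λ { conseq → conseq }
    ; replay = λ { conseq (⇒Lax a q d) → exchange d (↭-sym (to-front₁ _ q))
                 ; conseq (⇒L⊤ d) → d ; conseq (⇒L∧ _ _ d) → d ; conseq (⇒L∨₁ _ d) → d
                 ; conseq (⇒L∨₂ _ d) → d ; conseq (⇒L⇒ _ d) → d ; conseq (⇒L∀ _ d) → d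
                 ; conseq (⇒L∃ _ _ d) → d } }

-- Going under a binder shifts the context; inverting
-- ∃-left below a binder therefore produces two fresh variables in the
-- wrong order, which the renaming swap01 exchanges back.
swap01 : ℕ → ℕ
swap01 zero = 1
swap01 (suc zero) = 0
swap01 (suc (suc x)) = suc (suc x)

swap01-shift₁ : ∀ A → renF swap01 (shiftF 1 A) ≡ shiftF 0 A
swap01-shift₁ A = trans (ren-shift₁ swapped A) (sym (shift₀-ren A))
  where
  swapped : swap01 ∘ lift suc ≗ suc
  swapped zero = refl
  swapped (suc x) = refl

swap01-shift₀ : ∀ A → renF swap01 (shiftF 0 A) ≡ shiftF 1 A
swap01-shift₀ A = trans (ren-shift₀ swapped A) (sym (shift₁-ren A))
  where
  swapped : swap01 ∘ suc ≗ lift suc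
  swapped zero = refl
  swapped (suc x) = refl

shift₀-shift₀ : ∀ A → shiftF 0 (shiftF 0 A) ≡ shiftF 1 (shiftF 0 A)
shift₀-shift₀ A = begin
    shiftF 0 (shiftF 0 A)       ≡⟨ shift₀-ren (shiftF 0 A) ⟩
    renF suc (shiftF 0 A)       ≡⟨ ren-shift₀ (λ _ → refl) A ⟩
    renF (suc ∘ suc) A          ≡⟨ sym (ren-shift₀ (λ _ → refl) A) ⟩
    renF (lift suc) (shiftF 0 A) ≡⟨ sym (shift₁-ren (shiftF 0 A)) ⟩
    shiftF 1 (shiftF 0 A)       ∎
  where open ≡-Reasoning

swap01-shift₀² : ∀ A → renF swap01 (shiftF 0 (shiftF 0 A)) ≡ shiftF 0 (shiftF 0 A)
swap01-shift₀² A = trans (swap01-shift₀ (shiftF 0 A)) (sym (shift₀-shift₀ A))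

swap01-↑↑ : ∀ Θ → map (renF swap01) (↑ (↑ Θ)) ≡ ↑ (↑ Θ)
swap01-↑↑ [] = refl
swap01-↑↑ (A ∷ Θ) = cong₂ _∷_ (swap01-shift₀² A) (swap01-↑↑ Θ)

shift-[] : ∀ A t → shiftF 0 (A [ t ]) ≡ (shiftF 1 A) [ shiftT 0 t ]
shift-[] A t = begin
    shiftF 0 (A [ t ])                  ≡⟨ shift₀-ren (A [ t ]) ⟩
    renF suc (A [ t ])                  ≡⟨ renF-[] suc A t ⟩
    (renF (lift suc) A) [ renT suc t ]  ≡⟨ cong₂ _[_] (sym (shift₁-ren A)) (sym (shiftT₀-ren t)) ⟩
    (shiftF 1 A) [ shiftT 0 t ]         ∎
  where open ≡-Reasoning

swap-fresh : ∀ {X Θ G} → shiftF 1 X ∷ ↑ (↑ Θ) ⊢ shiftF 0 G → shiftF 0 X ∷ ↑ (↑ Θ) ⊢ shiftF 1 G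
swap-fresh {X} {Θ} {G} d =
  subst₂ _⊢_ (cong₂ _∷_ (swap01-shift₁ X) (swap01-↑↑ Θ)) (swap01-shift₀ G) (rename swap01 d)

swap-fresh₂ : ∀ {X Y Θ G} → shiftF 1 X ∷ shiftF 0 Y ∷ ↑ (↑ Θ) ⊢ shiftF 0 (shiftF 0 G) →
              shiftF 0 X ∷ shiftF 1 Y ∷ ↑ (↑ Θ) ⊢ shiftF 0 (shiftF 0 G)
swap-fresh₂ {X} {Y} {Θ} {G} d =
  subst₂ _⊢_ (cong₂ _∷_ (swap01-shift₁ X) (cong₂ _∷_ (swap01-shift₀ Y) (swap01-↑↑ Θ)))
    (swap01-shift₀² G) (rename swap01 d)

shift-atomic : ∀ {P} → Atomic P → Atomic (shiftF 0 P)
shift-atomic (atomic p ts) = atomic p _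

invert-∃ : ∀ {Γ G A Θ} → Γ ⊢ G → Γ ↭ ∃' A ∷ Θ → A ∷ ↑ Θ ⊢ shiftF 0 G

invert-∃-under : ∀ (E : List Form) {Δ G A Θ} → E ++ Δ ⊢ G → Δ ↭ ∃' A ∷ Θ → ↑ E ++ A ∷ ↑ Θ ⊢ shiftF 0 G
invert-∃-under E {G = G} {A} {Θ} d q =
  exchange (subst (λ Z → A ∷ Z ⊢ shiftF 0 G) (map-++ (shiftF 0) E Θ) (invert-∃ d (to-front E q)))
    (shifts (A ∷ []) (↑ E))

invert-∃ (ax a p) q with principal-cases p q
... | inj₁ (refl , _) with a
...   | ()
invert-∃ (ax a p) q | inj₂ (_ , q₁ , _) = ax (shift-atomic a) (to-front-↑ _ q₁)
invert-∃ ⊤R q = ⊤R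
invert-∃ (⊥L p) q with principal-cases p q
... | inj₁ (() , _)
... | inj₂ (_ , q₁ , _) = ⊥L (to-front-↑ _ q₁)
invert-∃ (∧L {A = X} {Y} p d) q with principal-cases p q
... | inj₁ (() , _)
... | inj₂ (_ , q₁ , q₂) = ∧L (to-front-↑ _ q₁) (invert-∃-under (X ∷ Y ∷ []) d q₂)
invert-∃ (∧R d e) q = ∧R (invert-∃ d q) (invert-∃ e q)
invert-∃ (∨L {A = X} {Y} p d e) q with principal-cases p q
... | inj₁ (() , _)
... | inj₂ (_ , q₁ , q₂) = ∨L (to-front-↑ _ q₁) (invert-∃-under (X ∷ []) d q₂) (invert-∃-under (Y ∷ []) e q₂)
invert-∃ (∨R₁ d) q = ∨R₁ (invert-∃ d q)
invert-∃ (∨R₂ d) q = ∨R₂ (invert-∃ d q)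
invert-∃ {A = A} (⇒Lax {P = P} {B} a p d) q with principal-cases p q
... | inj₁ (refl , _) with a
...   | ()
invert-∃ {A = A} (⇒Lax {P = P} {B} a p d) q | inj₂ (_ , q₁ , q₂) with ∷-↭-∷ q₂
... | inj₁ (() , _)
... | inj₂ (_ , q₃ , q₄) =
      ⇒Lax (shift-atomic a) (↭-trans (to-front-↑ A q₁) (↭-prep _ (to-front-↑ A q₃)))
        (invert-∃-under (P ∷ B ∷ []) d q₄)
invert-∃ (⇒L⊤ {B = B} p d) q with principal-cases p q
... | inj₁ (() , _)
... | inj₂ (_ , q₁ , q₂) = ⇒L⊤ (to-front-↑ _ q₁) (invert-∃-under (B ∷ []) d q₂)
invert-∃ (⇒L∧ {C = C} {D} {B} p d₁ d₂ d₃) q with principal-cases p q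
... | inj₁ (() , _)
... | inj₂ (_ , q₁ , q₂) =
      ⇒L∧ (to-front-↑ _ q₁) (invert-∃-under ((C ⇒ B) ∷ []) d₁ q₂) (invert-∃-under ((D ⇒ B) ∷ []) d₂ q₂)
        (invert-∃-under (B ∷ []) d₃ q₂)
invert-∃ (⇒L∨₁ {C = C} {D} {B} p d₁ d₂) q with principal-cases p q
... | inj₁ (() , _)
... | inj₂ (_ , q₁ , q₂) =
      ⇒L∨₁ (to-front-↑ _ q₁) (invert-∃-under ((C ⇒ B) ∷ (D ⇒ B) ∷ []) d₁ q₂) (invert-∃-under (B ∷ []) d₂ q₂)
invert-∃ (⇒L∨₂ {C = C} {D} {B} p d₁ d₂) q with principal-cases p q
... | inj₁ (() , _)
... | inj₂ (_ , q₁ , q₂) =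
      ⇒L∨₂ (to-front-↑ _ q₁) (invert-∃-under ((C ⇒ B) ∷ (D ⇒ B) ∷ []) d₁ q₂) (invert-∃-under (B ∷ []) d₂ q₂)
invert-∃ (⇒L⇒ {C = C} {D} {B} p d₁ d₂) q with principal-cases p q
... | inj₁ (() , _)
... | inj₂ (_ , q₁ , q₂) =
      ⇒L⇒ (to-front-↑ _ q₁) (invert-∃-under ((D ⇒ B) ∷ C ∷ []) d₁ q₂) (invert-∃-under (B ∷ []) d₂ q₂)
invert-∃ {A = A} (⇒L∀ {C = C} {B} p d₁ d₂) q with principal-cases p q
... | inj₁ (() , _)
... | inj₂ (Θ' , q₁ , q₂) =
      ⇒L∀ (to-front-↑ _ q₁)
        (swap-head (swap-fresh {X = A} {Θ = (∀' C ⇒ B) ∷ Θ'} {G = C}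
          (invert-∃ d₁ (to-front₁ (shiftF 0 (∀' C ⇒ B)) (map⁺ (shiftF 0) q₂)))))
        (invert-∃-under (B ∷ []) d₂ q₂)
invert-∃ (⇒L∃ {C = C} {B} t p d₁ d₂) q with principal-cases p q
... | inj₁ (() , _)
... | inj₂ (_ , q₁ , q₂) =
      ⇒L∃ (shiftT 0 t) (to-front-↑ _ q₁)
          (subst (_ ⊢_) (shift-[] C t) (invert-∃-under ((∃' C ⇒ B) ∷ []) d₁ q₂))
        (invert-∃-under (B ∷ []) d₂ q₂)
invert-∃ (⇒R {A = X} d) q = ⇒R (swap-head (invert-∃ d (to-front₁ X q)))
invert-∃ {A = A} {Θ = Θ} (∀R {A = G} d) q =
  ∀R (swap-fresh {X = A} {Θ = Θ} {G = G} (invert-∃ d (map⁺ (shiftF 0) q)))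
invert-∃ {G = G} {A = A} (contr∀L {A = A₀} t p d) q with principal-cases p q
... | inj₁ (() , _)
... | inj₂ (Θ' , q₁ , q₂) =
      contr∀L (shiftT 0 t) (to-front-↑ _ q₁)
        (subst (λ Z → ∀' (shiftF 1 A₀) ∷ Z ∷ A ∷ ↑ Θ' ⊢ shiftF 0 G) (shift-[] A₀ t)
          (invert-∃-under (∀' A₀ ∷ (A₀ [ t ]) ∷ []) d q₂))
invert-∃ {G = G} {A = A} (∃L {A = A₀} p d) q with principal-cases p q
... | inj₁ (refl , q') = exchange d (↭-prep _ (map⁺ (shiftF 0) q'))
... | inj₂ (Θ' , q₁ , q₂) =
      ∃L (to-front-↑ _ q₁)
        (swap-head (swap-fresh₂ {X = A} {Y = A₀} {Θ = Θ'} {G = G}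
          (invert-∃ d (to-front₁ A₀ (map⁺ (shiftF 0) q₂)))))
invert-∃ (∃R {A = A₀} t d) q = ∃R (shiftT 0 t) (subst (_ ⊢_) (shift-[] A₀ t) (invert-∃ d q))

-- (v) Contraction and the general ⇒-left rule

size : Form → ℕ
size (atom p ts) = 1
size ⊤' = 1
size ⊥' = 1
size (A ∧' B) = suc (size A + size B)
size (A ∨' B) = suc (size A + size B)
size (A ⇒ B) = suc (size A + size B)
size (∀' A) = suc (size A)
size (∃' A) = suc (size A)

size-ren : ∀ ρ A → size (renF ρ A) ≡ size A
size-ren ρ (atom p ts) = refl
size-ren ρ ⊤' = refl
size-ren ρ ⊥' = refl
size-ren ρ (A ∧' B) = cong₂ (λ a b → suc (a + b)) (size-ren ρ A) (size-ren ρ B)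
size-ren ρ (A ∨' B) = cong₂ (λ a b → suc (a + b)) (size-ren ρ A) (size-ren ρ B)
size-ren ρ (A ⇒ B) = cong₂ (λ a b → suc (a + b)) (size-ren ρ A) (size-ren ρ B)
size-ren ρ (∀' A) = cong suc (size-ren (lift ρ) A)
size-ren ρ (∃' A) = cong suc (size-ren (lift ρ) A)

size-shift-≤ : ∀ {A s} → size A ≤ s → size (shiftF 0 A) ≤ s
size-shift-≤ {A} {s} h = subst (_≤ s) (sym (trans (cong size (shift₀-ren A)) (size-ren suc A))) h

left≤ : ∀ {a b s} → suc (a + b) ≤ suc s → a ≤ s
left≤ {a} (s≤s h) = m+n≤o⇒m≤o a h

right≤ : ∀ {a b s} → suc (a + b) ≤ suc s → b ≤ s
right≤ {a} (s≤s h) = m+n≤o⇒n≤o a h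

left⇒≤ : ∀ {a b c s} → suc (a + b) + c ≤ s → suc (a + c) ≤ s
left⇒≤ {a} {b} {c} h = ≤-trans (s≤s (+-monoˡ-≤ c (m≤m+n a b))) h

right⇒≤ : ∀ {a b c s} → suc (a + b) + c ≤ s → suc (b + c) ≤ s
right⇒≤ {a} {b} {c} h = ≤-trans (s≤s (+-monoˡ-≤ c (m≤n+m b a))) h

antecedent≤ : ∀ {a b c s} → suc (a + b) + c ≤ s → a ≤ s
antecedent≤ {a} {b} {c} h = ≤-trans (m≤m+n a b) (≤-trans (m≤m+n (a + b) c) (≤-trans (n≤1+n _) h))

-- The formulas a ⇒-left rule puts in place of its principal formula, for
-- antecedents of size at most s (the induction measure).
data ⇒-components (s : ℕ) : Form → List Form → Set where
  conj₁ : ∀ {C D B} → size (C ∧' D) ≤ s → ⇒-components s ((C ∧' D) ⇒ B) ((C ⇒ B) ∷ [])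
  conj₂ : ∀ {C D B} → size (C ∧' D) ≤ s → ⇒-components s ((C ∧' D) ⇒ B) ((D ⇒ B) ∷ [])
  disj : ∀ {C D B} → size (C ∨' D) ≤ s → ⇒-components s ((C ∨' D) ⇒ B) ((C ⇒ B) ∷ (D ⇒ B) ∷ [])
  impl : ∀ {C D B} → size (C ⇒ D) ≤ s → ⇒-components s ((C ⇒ D) ⇒ B) ((D ⇒ B) ∷ C ∷ [])

⇒L-adm : ∀ s {Γ A B Θ G} → Γ ⊢ A → Γ ↭ (A ⇒ B) ∷ Θ → size A ≤ s → B ∷ Θ ⊢ G → (A ⇒ B) ∷ Θ ⊢ G

⇒L-adm-⇒R : ∀ s {Γ B Θ G C D} → C ∷ Γ ⊢ D → Γ ↭ ((C ⇒ D) ⇒ B) ∷ Θ → size (C ⇒ D) ≤ s →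
            B ∷ Θ ⊢ G → ((C ⇒ D) ⇒ B) ∷ Θ ⊢ G

⇒L-adm-under : ∀ s (E : List Form) {Δ A B Θ G} → E ++ Δ ⊢ A → Δ ↭ (A ⇒ B) ∷ Θ → size A ≤ s →
               B ∷ E ++ Θ ⊢ G → E ++ (A ⇒ B) ∷ Θ ⊢ G

contract : ∀ s {Γ A Θ G} → Γ ⊢ G → Γ ↭ A ∷ A ∷ Θ → size A ≤ s → A ∷ Θ ⊢ G

contract-under : ∀ s (E : List Form) {Δ A Θ G} → E ++ Δ ⊢ G → Δ ↭ A ∷ A ∷ Θ → size A ≤ s → E ++ A ∷ Θ ⊢ G

contract-pair : ∀ s {X Y Θ G} → X ∷ Y ∷ X ∷ Y ∷ Θ ⊢ G → size X ≤ s → size Y ≤ s → X ∷ Y ∷ Θ ⊢ G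

-- Contraction of the principal formula of a rule, premise by premise: the
-- premise d still contains the second copy (in Δ), which is inverted and
-- contracted into the components produced by the rule.
contract-∧ : ∀ s {X Y Θ G Δ} → X ∷ Y ∷ Δ ⊢ G → Δ ↭ (X ∧' Y) ∷ Θ → size (X ∧' Y) ≤ s → (X ∧' Y) ∷ Θ ⊢ G
contract-∨ : ∀ s {X Y Θ G Δ} → X ∷ Δ ⊢ G → Y ∷ Δ ⊢ G → Δ ↭ (X ∨' Y) ∷ Θ → size (X ∨' Y) ≤ s →
             (X ∨' Y) ∷ Θ ⊢ G
contract-conseq : ∀ s {X B Θ G Δ} → B ∷ Δ ⊢ G → Δ ↭ (X ⇒ B) ∷ Θ → size (X ⇒ B) ≤ s → B ∷ Θ ⊢ G
contract-⇒ax : ∀ s {P B Θ G Δ} → P ∷ B ∷ Δ ⊢ G → Δ ↭ (P ⇒ B) ∷ Θ → size (P ⇒ B) ≤ s → P ∷ B ∷ Θ ⊢ G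
contract-⇒∧₁ : ∀ s {C D B Θ Δ} → (C ⇒ B) ∷ Δ ⊢ C → Δ ↭ ((C ∧' D) ⇒ B) ∷ Θ →
               size ((C ∧' D) ⇒ B) ≤ s → (C ⇒ B) ∷ Θ ⊢ C
contract-⇒∧₂ : ∀ s {C D B Θ Δ} → (D ⇒ B) ∷ Δ ⊢ D → Δ ↭ ((C ∧' D) ⇒ B) ∷ Θ →
               size ((C ∧' D) ⇒ B) ≤ s → (D ⇒ B) ∷ Θ ⊢ D
contract-⇒∨ : ∀ s {C D B Θ Δ G} → (C ⇒ B) ∷ (D ⇒ B) ∷ Δ ⊢ G → Δ ↭ ((C ∨' D) ⇒ B) ∷ Θ →
              size ((C ∨' D) ⇒ B) ≤ s → (C ⇒ B) ∷ (D ⇒ B) ∷ Θ ⊢ G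
contract-⇒⇒ : ∀ s {C D B Θ Δ} → (D ⇒ B) ∷ C ∷ Δ ⊢ D → Δ ↭ ((C ⇒ D) ⇒ B) ∷ Θ →
              size ((C ⇒ D) ⇒ B) ≤ s → (D ⇒ B) ∷ C ∷ Θ ⊢ D
contract-∃ : ∀ s {A Δ Θ G} → A ∷ ↑ Δ ⊢ shiftF 0 G → Δ ↭ ∃' A ∷ Θ → size (∃' A) ≤ s → A ∷ ↑ Θ ⊢ shiftF 0 G

-- Inversion of the ⇒-left rules with compound antecedent: the rules are
-- replayed with the general ⇒-left rule at smaller size.
replay-⇒ : ∀ s {X Ys Θ G} → ⇒-components s X Ys → Principal X Θ G → Ys ++ Θ ⊢ G

invert-⇒ : ∀ s {Γ G X Ys Θ} → Γ ⊢ G → Γ ↭ X ∷ Θ → ⇒-components s X Ys → Ys ++ Θ ⊢ G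
invert-⇒ s = invert (record { compound = λ { (conj₁ _) () ; (conj₂ _) () ; (disj _) () ; (impl _) () }
                            ; shift-stable = shift-components
                            ; replay = replay-⇒ s })
  where
  shift-components : ∀ {X Ys} → ⇒-components s X Ys → ⇒-components s (shiftF 0 X) (↑ Ys)
  shift-components (conj₁ {C} {D} h) = conj₁ (size-shift-≤ {C ∧' D} h)
  shift-components (conj₂ {C} {D} h) = conj₂ (size-shift-≤ {C ∧' D} h)
  shift-components (disj {C} {D} h) = disj (size-shift-≤ {C ∨' D} h)
  shift-components (impl {C} {D} h) = impl (size-shift-≤ {C ⇒ D} h)

-- No compound formula has size 0; atoms are never principal here.
replay-⇒ zero (conj₁ ()) _
replay-⇒ zero (conj₂ ()) _
replay-⇒ zero (disj ()) _
replay-⇒ zero (impl ()) _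
replay-⇒ (suc s) (conj₁ _) (⇒Lax () _ _)
replay-⇒ (suc s) (conj₂ _) (⇒Lax () _ _)
replay-⇒ (suc s) (disj _) (⇒Lax () _ _)
replay-⇒ (suc s) (impl _) (⇒Lax () _ _)
replay-⇒ (suc s) (conj₁ h) (⇒L∧ d₁ _ d₃) = ⇒L-adm s d₁ ↭-refl (left≤ h) d₃
replay-⇒ (suc s) (conj₂ h) (⇒L∧ _ d₂ d₃) = ⇒L-adm s d₂ ↭-refl (right≤ h) d₃
replay-⇒ (suc s) (disj h) (⇒L∨₁ d₁ d₂) = ⇒L-adm s d₁ ↭-refl (left≤ h) (swap-head (weaken _ d₂))
replay-⇒ (suc s) (disj h) (⇒L∨₂ d₁ d₂) =
  swap-head (⇒L-adm s (swap-head d₁) ↭-refl (right≤ h) (swap-head (weaken _ d₂)))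
replay-⇒ (suc s) (impl h) (⇒L⇒ d₁ d₂) = ⇒L-adm s d₁ ↭-refl (right≤ h) (swap-head (weaken _ d₂))

-- Inversion of X ⇒ B' to B' inside the rest of a context B ∷ Θ; this
-- prepares the right premise when a ⇒-left rule is permuted below.
conseq-inv : ∀ {B X B' Θ Θ' G} → B ∷ Θ ⊢ G → Θ ↭ (X ⇒ B') ∷ Θ' → B ∷ B' ∷ Θ' ⊢ G
conseq-inv {B} e q = swap-head (invert-⇒-conseq e (to-front₁ B q))

⇒L-adm-under s E {A = A} {B} d q h e = exchange (⇒L-adm s d (to-front E q) h e) (shifts ((A ⇒ B) ∷ []) E)

-- Induction on the left premise: right rules on A are matched by the
-- corresponding ⇒-left rule, left rules are permuted below.
⇒L-adm s (ax a p) q h e with principal-cases p q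
... | inj₁ (() , _)
... | inj₂ (_ , q₁ , _) = ⇒Lax a (to-front₁ _ q₁) (exchange e (to-front₁ _ q₁))
⇒L-adm s ⊤R q h e = ⇒L⊤ ↭-refl e
⇒L-adm s (⊥L p) q h e with principal-cases p q
... | inj₁ (() , _)
... | inj₂ (_ , q₁ , _) = ⊥L (to-front₁ _ q₁)
⇒L-adm s {B = B} (∧L {A = X} {Y} p d) q h e with principal-cases p q
... | inj₁ (() , _)
... | inj₂ (_ , q₁ , q₂) =
      ∧L (to-front₁ _ q₁)
        (⇒L-adm-under s (X ∷ Y ∷ []) d q₂ h
            (exchange (invert-∧ e (to-front₁ B q₁)) (shifts (X ∷ Y ∷ []) (B ∷ []))))
⇒L-adm s (∧R d₁ d₂) q h e = ⇒L∧ ↭-refl (invert-⇒ s d₁ q (conj₁ h)) (invert-⇒ s d₂ q (conj₂ h)) e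
⇒L-adm s {B = B} (∨L {A = X} {Y} p d₁ d₂) q h e with principal-cases p q
... | inj₁ (() , _)
... | inj₂ (_ , q₁ , q₂) =
      ∨L (to-front₁ _ q₁)
        (⇒L-adm-under s (X ∷ []) d₁ q₂ h (swap-head (invert-∨₁ e (to-front₁ B q₁))))
        (⇒L-adm-under s (Y ∷ []) d₂ q₂ h (swap-head (invert-∨₂ e (to-front₁ B q₁))))
⇒L-adm s (∨R₁ d) q h e = ⇒L∨₁ ↭-refl (invert-⇒ s d q (disj h)) e
⇒L-adm s (∨R₂ d) q h e = ⇒L∨₂ ↭-refl (invert-⇒ s d q (disj h)) e
⇒L-adm s {B = B} (⇒Lax {P = P} {B'} a p d) q h e with principal-cases p q
... | inj₁ (refl , _) with a
...   | ()
⇒L-adm s {B = B} (⇒Lax {P = P} {B'} a p d) q h e | inj₂ (_ , q₁ , q₂) with ∷-↭-∷ q₂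
... | inj₁ (refl , _) = ⇒Lax a (to-front₁ _ q₁) (exchange e (to-front₁ _ q₁))
... | inj₂ (_ , q₃ , q₄) =
      ⇒Lax a (↭-trans (to-front₁ _ q₁) (↭-prep P (to-front₁ _ q₃)))
        (⇒L-adm-under s (P ∷ B' ∷ []) d q₄ h
          (exchange (invert-⇒-conseq e (↭-trans (↭-prep B (↭-trans q₁ (↭-prep P q₃)))
                                                 (shifts (B ∷ P ∷ []) ((P ⇒ B') ∷ []))))
                    (shifts (B' ∷ []) (B ∷ P ∷ []))))
⇒L-adm s (⇒L⊤ {B = B'} p d) q h e with principal-cases p q
... | inj₁ (refl , _) = ⇒L⊤ ↭-refl e
... | inj₂ (_ , q₁ , q₂) = ⇒L⊤ (to-front₁ _ q₁) (⇒L-adm-under s (B' ∷ []) d q₂ h (conseq-inv e q₁))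
⇒L-adm s (⇒L∧ {B = B'} p d₁ d₂ d₃) q h e with principal-cases p q
... | inj₁ (refl , q') = ⇒L∧ ↭-refl (exchange d₁ (↭-prep _ q')) (exchange d₂ (↭-prep _ q')) e
... | inj₂ (_ , q₁ , q₂) =
      ⇒L∧ (to-front₁ _ q₁) (exchange d₁ (↭-prep _ q₂)) (exchange d₂ (↭-prep _ q₂))
        (⇒L-adm-under s (B' ∷ []) d₃ q₂ h (conseq-inv e q₁))
⇒L-adm s (⇒L∨₁ {B = B'} p d₁ d₂) q h e with principal-cases p q
... | inj₁ (refl , q') = ⇒L∨₁ ↭-refl (exchange d₁ (↭-prep _ (↭-prep _ q'))) e
... | inj₂ (_ , q₁ , q₂) =
      ⇒L∨₁ (to-front₁ _ q₁) (exchange d₁ (↭-prep _ (↭-prep _ q₂)))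
          (⇒L-adm-under s (B' ∷ []) d₂ q₂ h (conseq-inv e q₁))
⇒L-adm s (⇒L∨₂ {B = B'} p d₁ d₂) q h e with principal-cases p q
... | inj₁ (refl , q') = ⇒L∨₂ ↭-refl (exchange d₁ (↭-prep _ (↭-prep _ q'))) e
... | inj₂ (_ , q₁ , q₂) =
      ⇒L∨₂ (to-front₁ _ q₁) (exchange d₁ (↭-prep _ (↭-prep _ q₂)))
          (⇒L-adm-under s (B' ∷ []) d₂ q₂ h (conseq-inv e q₁))
⇒L-adm s (⇒L⇒ {B = B'} p d₁ d₂) q h e with principal-cases p q
... | inj₁ (refl , q') = ⇒L⇒ ↭-refl (exchange d₁ (↭-prep _ (↭-prep _ q'))) e
... | inj₂ (_ , q₁ , q₂) =
      ⇒L⇒ (to-front₁ _ q₁) (exchange d₁ (↭-prep _ (↭-prep _ q₂)))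
          (⇒L-adm-under s (B' ∷ []) d₂ q₂ h (conseq-inv e q₁))
⇒L-adm s (⇒L∀ {B = B'} p d₁ d₂) q h e with principal-cases p q
... | inj₁ (refl , q') = ⇒L∀ ↭-refl (exchange d₁ (map⁺ (shiftF 0) (↭-prep _ q'))) e
... | inj₂ (_ , q₁ , q₂) =
      ⇒L∀ (to-front₁ _ q₁) (exchange d₁ (map⁺ (shiftF 0) (↭-prep _ q₂)))
          (⇒L-adm-under s (B' ∷ []) d₂ q₂ h (conseq-inv e q₁))
⇒L-adm s (⇒L∃ {B = B'} t p d₁ d₂) q h e with principal-cases p q
... | inj₁ (refl , q') = ⇒L∃ t ↭-refl (exchange d₁ (↭-prep _ q')) e
... | inj₂ (_ , q₁ , q₂) =
      ⇒L∃ t (to-front₁ _ q₁) (exchange d₁ (↭-prep _ q₂)) (⇒L-adm-under s (B' ∷ []) d₂ q₂ h (conseq-inv e q₁))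
⇒L-adm s (⇒R d) q h e = ⇒L-adm-⇒R s d q h e
⇒L-adm s (∀R d) q h e = ⇒L∀ ↭-refl (exchange d (map⁺ (shiftF 0) q)) e
⇒L-adm s {B = B} (contr∀L {A = A₀} t p d) q h e with principal-cases p q
... | inj₁ (() , _)
... | inj₂ (_ , q₁ , q₂) =
      contr∀L t (to-front₁ _ q₁)
        (⇒L-adm-under s (∀' A₀ ∷ (A₀ [ t ]) ∷ []) d q₂ h
          (exchange (weaken (A₀ [ t ]) e)
                    (↭-trans (↭-prep _ (↭-prep B q₁)) (shifts ((A₀ [ t ]) ∷ []) (B ∷ ∀' A₀ ∷ [])))))
⇒L-adm s {A = A} {B} (∃L {A = A₀} p d) q h e with principal-cases p q
... | inj₁ (() , _)
... | inj₂ (_ , q₁ , q₂) =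
      ∃L (to-front₁ _ q₁)
        (swap-head (⇒L-adm s d (to-front₁ A₀ (map⁺ (shiftF 0) q₂)) (size-shift-≤ {A} h)
                     (swap-head (invert-∃ e (to-front₁ B q₁)))))
⇒L-adm s (∃R t d) q h e = ⇒L∃ t ↭-refl (exchange d q) e

-- From C ∷ (C ⇒ D) ⇒ B ∷ Θ ⊢ D: invert to (D ⇒ B) ∷ C ∷ C ∷ Θ ⊢ D and
-- contract C, which is smaller than C ⇒ D.
⇒L-adm-⇒R zero d q () e
⇒L-adm-⇒R (suc s) {B = B} {C = C} {D} d q h e =
  ⇒L⇒ ↭-refl
    (swap-head
        (contract s (invert-⇒ (suc s) d (to-front₁ C q) (impl h)) (shifts ((D ⇒ B) ∷ []) (C ∷ C ∷ []))
            (left≤ h)))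
    e

contract-under s E {A = A} d q h = exchange (contract s d (to-front₂ E q) h) (shifts (A ∷ []) E)

contract-pair s {X} {Y} d hx hy =
  swap-head (contract s (contract s d (↭-prep X (↭-swap Y X ↭-refl)) hx) (shifts (X ∷ []) (Y ∷ Y ∷ [])) hy)

contract-∧ zero d r ()
contract-∧ (suc s) {X} {Y} d r h =
  ∧L ↭-refl (contract-pair s (invert-∧ d (to-front (X ∷ Y ∷ []) r)) (left≤ h) (right≤ h))

contract-∨ zero d e r ()
contract-∨ (suc s) {X} {Y} d e r h =
  ∨L ↭-refl (contract s (invert-∨₁ d (to-front₁ X r)) ↭-refl (left≤ h))
            (contract s (invert-∨₂ e (to-front₁ Y r)) ↭-refl (right≤ h))

contract-conseq zero d r ()
contract-conseq (suc s) {B = B} d r h = contract s (invert-⇒-conseq d (to-front₁ B r)) ↭-refl (right≤ h)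

contract-⇒ax zero d r ()
contract-⇒ax (suc s) {P} {B} d r h =
  swap-head (contract s (invert-⇒-conseq d (to-front (P ∷ B ∷ []) r)) (↭-prep B (↭-swap P B ↭-refl)) (right≤ h))

contract-⇒∧₁ zero d r ()
contract-⇒∧₁ (suc s) {C} {D} {B} d r (s≤s h) =
  contract s (invert-⇒ s d (to-front₁ (C ⇒ B) r) (conj₁ (m+n≤o⇒m≤o _ h))) ↭-refl
      (left⇒≤ {size C} {size D} {size B} h)

contract-⇒∧₂ zero d r ()
contract-⇒∧₂ (suc s) {C} {D} {B} d r (s≤s h) =
  contract s (invert-⇒ s d (to-front₁ (D ⇒ B) r) (conj₂ (m+n≤o⇒m≤o _ h))) ↭-refl
      (right⇒≤ {size C} {size D} {size B} h)

contract-⇒∨ zero d r ()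
contract-⇒∨ (suc s) {C} {D} {B} d r (s≤s h) =
  contract-pair s (invert-⇒ s d (to-front ((C ⇒ B) ∷ (D ⇒ B) ∷ []) r) (disj (m+n≤o⇒m≤o _ h)))
    (left⇒≤ {size C} {size D} {size B} h) (right⇒≤ {size C} {size D} {size B} h)

contract-⇒⇒ zero d r ()
contract-⇒⇒ (suc s) {C} {D} {B} d r (s≤s h) =
  contract-pair s (invert-⇒ s d (to-front ((D ⇒ B) ∷ C ∷ []) r) (impl (m+n≤o⇒m≤o _ h)))
    (right⇒≤ {size C} {size D} {size B} h) (antecedent≤ {size C} {size D} {size B} h)

-- The second copy of ∃A is inverted under the binder and the two fresh
-- variables are then identified by the renaming pred.
contract-∃ zero d r ()
contract-∃ (suc s) {A} {Δ} {Θ} {G} d r (s≤s h) =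
  contract s
      (subst₂ _⊢_ (cong₂ _∷_ (pred-shift₁ A) (cong₂ _∷_ (pred-shift₀ A) (pred-↑↑ Θ)))
          (pred-shift₀ (shiftF 0 G))
                (rename pred (invert-∃ d (to-front₁ A (map⁺ (shiftF 0) r)))))
    ↭-refl h
  where
  pred-shift₀ : ∀ A → renF pred (shiftF 0 A) ≡ A
  pred-shift₀ A = trans (ren-shift₀ (λ _ → refl) A) (renF-id (λ _ → refl) A)

  pred-shift₁ : ∀ A → renF pred (shiftF 1 A) ≡ A
  pred-shift₁ A = trans (ren-shift₁ {τ = id} (λ { zero → refl ; (suc x) → refl }) A) (renF-id (λ _ → refl) A)

  pred-↑↑ : ∀ Θ → map (renF pred) (↑ (↑ Θ)) ≡ ↑ Θ
  pred-↑↑ [] = refl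
  pred-↑↑ (A ∷ Θ) = cong₂ _∷_ (pred-shift₀ (shiftF 0 A)) (pred-↑↑ Θ)

-- Induction on the derivation: if the rule acts on one copy of A, the
-- other copy is inverted and contracted at smaller size; otherwise the
-- rule is permuted below the contraction.
contract s (ax a p) q h with principal-cases₂ p q
... | inj₁ (refl , _) = ax a ↭-refl
... | inj₂ (_ , q₁ , _) = ax a (to-front₁ _ q₁)
contract s ⊤R q h = ⊤R
contract s (⊥L p) q h with principal-cases₂ p q
... | inj₁ (refl , _) = ⊥L ↭-refl
... | inj₂ (_ , q₁ , _) = ⊥L (to-front₁ _ q₁)
contract s (∧L {A = X} {Y} p d) q h with principal-cases₂ p q
... | inj₁ (refl , r) = contract-∧ s d r h
... | inj₂ (_ , q₁ , q₂) = ∧L (to-front₁ _ q₁) (contract-under s (X ∷ Y ∷ []) d q₂ h)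
contract s (∧R d e) q h = ∧R (contract s d q h) (contract s e q h)
contract s (∨L {A = X} {Y} p d e) q h with principal-cases₂ p q
... | inj₁ (refl , r) = contract-∨ s d e r h
... | inj₂ (_ , q₁ , q₂) = ∨L (to-front₁ _ q₁) (contract-under s (X ∷ []) d q₂ h)
      (contract-under s (Y ∷ []) e q₂ h)
contract s (∨R₁ d) q h = ∨R₁ (contract s d q h)
contract s (∨R₂ d) q h = ∨R₂ (contract s d q h)
contract s (⇒Lax {P = P} {B} a p d) q h with principal-cases₂ p q
... | inj₁ (refl , r) with ∷-↭-∷ r
...   | inj₁ (() , _)
...   | inj₂ (_ , u₁ , u₂) =
        ⇒Lax a (↭-prep _ u₁) (contract s d (↭-prep P (↭-trans (↭-prep B u₂) (↭-swap B P ↭-refl))) h)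
contract s (⇒Lax {P = P} {B} a p d) q h | inj₂ (_ , q₁ , q₂) with principal-cases₂ ↭-refl q₂
... | inj₁ (refl , r) = ⇒Lax a (to-front₁ _ q₁) (contract-⇒ax s d r h)
... | inj₂ (_ , u₁ , u₂) =
      ⇒Lax a (↭-trans (to-front₁ _ q₁) (↭-prep P (to-front₁ _ u₁))) (contract-under s (P ∷ B ∷ []) d u₂ h)
contract s (⇒L⊤ {B = B} p d) q h with principal-cases₂ p q
... | inj₁ (refl , r) = ⇒L⊤ ↭-refl (contract-conseq s d r h)
... | inj₂ (_ , q₁ , q₂) = ⇒L⊤ (to-front₁ _ q₁) (contract-under s (B ∷ []) d q₂ h)
contract s (⇒L∧ {C = C} {D} {B} p d₁ d₂ d₃) q h with principal-cases₂ p q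
... | inj₁ (refl , r) = ⇒L∧ ↭-refl (contract-⇒∧₁ s d₁ r h) (contract-⇒∧₂ s d₂ r h) (contract-conseq s d₃ r h)
... | inj₂ (_ , q₁ , q₂) =
      ⇒L∧ (to-front₁ _ q₁) (contract-under s ((C ⇒ B) ∷ []) d₁ q₂ h) (contract-under s ((D ⇒ B) ∷ []) d₂ q₂ h)
        (contract-under s (B ∷ []) d₃ q₂ h)
contract s (⇒L∨₁ {C = C} {D} {B} p d₁ d₂) q h with principal-cases₂ p q
... | inj₁ (refl , r) = ⇒L∨₁ ↭-refl (contract-⇒∨ s d₁ r h) (contract-conseq s d₂ r h)
... | inj₂ (_ , q₁ , q₂) =
      ⇒L∨₁ (to-front₁ _ q₁) (contract-under s ((C ⇒ B) ∷ (D ⇒ B) ∷ []) d₁ q₂ h)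
          (contract-under s (B ∷ []) d₂ q₂ h)
contract s (⇒L∨₂ {C = C} {D} {B} p d₁ d₂) q h with principal-cases₂ p q
... | inj₁ (refl , r) = ⇒L∨₂ ↭-refl (contract-⇒∨ s d₁ r h) (contract-conseq s d₂ r h)
... | inj₂ (_ , q₁ , q₂) =
      ⇒L∨₂ (to-front₁ _ q₁) (contract-under s ((C ⇒ B) ∷ (D ⇒ B) ∷ []) d₁ q₂ h)
          (contract-under s (B ∷ []) d₂ q₂ h)
contract s (⇒L⇒ {C = C} {D} {B} p d₁ d₂) q h with principal-cases₂ p q
... | inj₁ (refl , r) = ⇒L⇒ ↭-refl (contract-⇒⇒ s d₁ r h) (contract-conseq s d₂ r h)
... | inj₂ (_ , q₁ , q₂) =
      ⇒L⇒ (to-front₁ _ q₁) (contract-under s ((D ⇒ B) ∷ C ∷ []) d₁ q₂ h) (contract-under s (B ∷ []) d₂ q₂ h)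
contract s {A = A} (⇒L∀ {C = C} {B} p d₁ d₂) q h with principal-cases₂ p q
... | inj₁ (refl , r) =
      ⇒L∀ ↭-refl (contract s d₁ (map⁺ (shiftF 0) (↭-prep _ r)) (size-shift-≤ {A} h))
          (contract-conseq s d₂ r h)
... | inj₂ (_ , q₁ , q₂) =
      ⇒L∀ (to-front₁ _ q₁)
        (swap-head
            (contract s d₁ (to-front₂ (shiftF 0 (∀' C ⇒ B) ∷ []) (map⁺ (shiftF 0) q₂)) (size-shift-≤ {A} h)))
        (contract-under s (B ∷ []) d₂ q₂ h)
contract s (⇒L∃ {C = C} {B} t p d₁ d₂) q h with principal-cases₂ p q
... | inj₁ (refl , r) = ⇒L∃ t ↭-refl (contract s d₁ (↭-prep _ r) h) (contract-conseq s d₂ r h)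
... | inj₂ (_ , q₁ , q₂) =
      ⇒L∃ t (to-front₁ _ q₁) (contract-under s ((∃' C ⇒ B) ∷ []) d₁ q₂ h) (contract-under s (B ∷ []) d₂ q₂ h)
contract s (⇒R {A = X} d) q h = ⇒R (swap-head (contract s d (to-front₂ (X ∷ []) q) h))
contract s {A = A} (∀R d) q h = ∀R (contract s d (map⁺ (shiftF 0) q) (size-shift-≤ {A} h))
contract s (contr∀L {A = A₀} t p d) q h with principal-cases₂ p q
... | inj₁ (refl , r) = contr∀L t ↭-refl (contract s d (↭-prep _ (to-front₁ (A₀ [ t ]) r)) h)
... | inj₂ (_ , q₁ , q₂) = contr∀L t (to-front₁ _ q₁) (contract-under s (∀' A₀ ∷ (A₀ [ t ]) ∷ []) d q₂ h)
contract s {A = A} (∃L {A = A₀} p d) q h with principal-cases₂ p q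
... | inj₁ (refl , r) = ∃L ↭-refl (contract-∃ s d r h)
... | inj₂ (_ , q₁ , q₂) =
      ∃L (to-front₁ _ q₁)
          (swap-head (contract s d (to-front₂ (A₀ ∷ []) (map⁺ (shiftF 0) q₂)) (size-shift-≤ {A} h)))
contract s (∃R t d) q h = ∃R t (contract s d q h)

lemma8 : (∀ (Γ : List Form) (C D B G : Form) →
    ((C ∧' D) ⇒ B) ∷ Γ ⊢ G →
    ((C ⇒ B) ∷ Γ ⊢ G) × ((D ⇒ B) ∷ Γ ⊢ G))
    × (∀ (Γ : List Form) (C D B G : Form) →
    ((C ∨' D) ⇒ B) ∷ Γ ⊢ G →
    (C ⇒ B) ∷ (D ⇒ B) ∷ Γ ⊢ G)
    × (∀ (Γ : List Form) (C D B G : Form) →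
    ((C ⇒ D) ⇒ B) ∷ Γ ⊢ G →
    (D ⇒ B) ∷ C ∷ Γ ⊢ G)
    × (∀ (Γ : List Form) (A G : Form) →
    A ∷ A ∷ Γ ⊢ G →
    A ∷ Γ ⊢ G)
    × (∀ (Γ : List Form) (A B G : Form) →
    (A ⇒ B) ∷ Γ ⊢ A →
    B ∷ Γ ⊢ G →
    (A ⇒ B) ∷ Γ ⊢ G)
lemma8 =
    (λ Γ C D B G d → invert-⇒ _ d ↭-refl (conj₁ ≤-refl) , invert-⇒ _ d ↭-refl (conj₂ ≤-refl))
  , (λ Γ C D B G d → invert-⇒ _ d ↭-refl (disj ≤-refl))
  , (λ Γ C D B G d → invert-⇒ _ d ↭-refl (impl ≤-refl))
  , (λ Γ A G d → contract (size A) d ↭-refl ≤-refl)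
  , (λ Γ A B G d e → ⇒L-adm (size A) d ↭-refl ≤-refl e)
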